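{- Let $n\equiv 1\pmod 4$ with $n\geq 9$. Then there exists an $\mathrm{SH}^*(n;7)$.
   Context: An $\mathrm{H}(n;k)$ is an $n\times n$ partially filled array with entries in $\{\pm1,\dots,\pm nk\}\subset\mathbb{Z}$ such that no two entries agree in absolute value, each row and each column has exactly $k$ filled cells, and every row and every column sums to $0$ in $\mathbb{Z}$. An ordering $(a_1,\dots,a_k)$ is simple modulo $v$ if its partial sums $s_i=\sum_{j\le i}a_j$ are pairwise distinct modulo $v$. An $\mathrm{SH}^*(n;k)$ is an $\mathrm{H}(n;k)$ in which the natural ordering of each row (left to right, skipping empty cells) and each column (top to bottom, skipping empty cells) is simple both modulo $2nk+1$ and modulo $2nk+2$. -}

module Defs where

open import Data.Nat as ℕ using (ℕ; suc; NonZero)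
open import Data.Integer as ℤ using (ℤ; +_)
open import Data.Integer.DivMod using (_%ℕ_)
open import Data.Fin using (Fin)
open import Data.Maybe using (Maybe; just; nothing)
open import Data.List using (List; []; _∷_; catMaybes; length; tabulate; map; foldr)
open import Data.List.Relation.Unary.Unique.Propositional using (Unique)
open import Data.Product using (_×_; Σ)
open import Relation.Binary.PropositionalEquality using (_≡_; _≢_)

PArray : ℕ → Set
PArray n = Fin n → Fin n → Maybe ℤ

rowList : ∀ {n} → PArray n → Fin n → List ℤ
rowList A i = catMaybes (tabulate (λ j → A i j))

colList : ∀ {n} → PArray n → Fin n → List ℤ
colList A j = catMaybes (tabulate (λ i → A i j))

sumℤ : List ℤ → ℤ
sumℤ = foldr ℤ._+_ (+ 0)

partialSums : List ℤ → List ℤ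
partialSums = go (+ 0)
  where
  go : ℤ → List ℤ → List ℤ
  go acc []       = []
  go acc (x ∷ xs) = (acc ℤ.+ x) ∷ go (acc ℤ.+ x) xs

SimpleMod : (v : ℕ) → .{{NonZero v}} → List ℤ → Set
SimpleMod v xs = Unique (map (λ s → s %ℕ v) (partialSums xs))

record IsH (n k : ℕ) (A : PArray n) : Set where
  field
    entries   : ∀ i j x → A i j ≡ just x → (x ≢ + 0) × (ℤ.∣ x ∣ ℕ.≤ n ℕ.* k)
    absInj    : ∀ i j i′ j′ x y → A i j ≡ just x → A i′ j′ ≡ just y →
                ℤ.∣ x ∣ ≡ ℤ.∣ y ∣ → (i ≡ i′) × (j ≡ j′)
    rowCount  : ∀ i → length (rowList A i) ≡ k
    colCount  : ∀ j → length (colList A j) ≡ k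
    rowSum    : ∀ i → sumℤ (rowList A i) ≡ + 0
    colSum    : ∀ j → sumℤ (colList A j) ≡ + 0

record IsSHStar (n k : ℕ) (A : PArray n) : Set where
  field
    isH      : IsH n k A
    rowSimp₁ : ∀ i → SimpleMod (suc (2 ℕ.* n ℕ.* k)) (rowList A i)
    rowSimp₂ : ∀ i → SimpleMod (suc (suc (2 ℕ.* n ℕ.* k))) (rowList A i)
    colSimp₁ : ∀ j → SimpleMod (suc (2 ℕ.* n ℕ.* k)) (colList A j)
    colSimp₂ : ∀ j → SimpleMod (suc (suc (2 ℕ.* n ℕ.* k))) (colList A j)

SHStar : ℕ → ℕ → Set
SHStar n k = Σ (PArray n) (IsSHStar n k)

-- Write n = s + 8N with s ∈ {9, 13} and take a block-diagonal array: an s × s corner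
-- followed by N copies of one 8 × 8 block. Each filled cell holds ±(d (a x + b y) + c) for an
-- affine form of its kind, evaluated at (d, x, y) = (28, N, 0) in the corner and at
-- (14, t, N − 1 − t) in block t. The five kinds fill consecutive segments of [1, 7n], and the
-- tables list where every value sits, so the absolute values of the entries are distinct.
-- In every row and column the forms sum to the zero form, and all partial sums are bounded
-- by a form of value 7n and pairwise differ by forms that cannot vanish; integers of absolute
-- value at most 7n that agree modulo some v > 14n are equal, so every line is simple modulo
-- 14n + 1 and 14n + 2. For each s these are finitely many conditions on the tables, and they
-- are decided by evaluation.

module Submission where

open import Defs
open import Data.Nat using (ℕ; _≤_; _%_)
open import Relation.Binary.PropositionalEquality using (_≡_)

open import Data.Bool using (Bool; true; false; T; _∧_; _∨_; not)
open import Data.Bool.Properties using (T-∧; T-∨)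
open import Data.Empty using (⊥-elim)
open import Data.Unit using (⊤; tt)
open import Data.Fin using (toℕ)
import Data.Fin.Properties as Fin
open import Data.Maybe using (Maybe; just; nothing)
import Data.Maybe as Maybe
open import Data.Integer as ℤ using (ℤ; +_; -[1+_]; +[1+_]; ∣_∣)
  renaming (_+_ to _+ℤ_; _*_ to _*ℤ_; -_ to -ℤ_; _-_ to _-ℤ_)
import Data.Integer.Properties as ℤ
open import Data.Integer.DivMod using (_%ℕ_; _/ℕ_; a≡a%ℕn+[a/ℕn]*n)
open import Data.Integer.Tactic.RingSolver using (solve-∀)
open import Data.List using (List; []; _∷_; _++_; length; map; tabulate; catMaybes)
open import Data.List.Relation.Unary.All using (All; []; _∷_)
import Data.List.Relation.Unary.All as All
import Data.List.Relation.Unary.All.Properties as Allₚ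
import Data.List.Relation.Unary.AllPairs as AllPairs
import Data.List.Relation.Unary.AllPairs.Properties as AllPairsₚ
open import Data.List.Relation.Unary.AllPairs using (AllPairs; []; _∷_; allPairs?)
open import Data.Nat as ℕ using (zero; suc; _+_; _*_; _∸_; _<_; NonZero; z<s; s≤s)
open import Data.Nat.Divisibility using (_∣_; divides; _∣?_; ∣⇒≤)
import Data.Nat.Properties as ℕ
import Data.Nat.DivMod as ℕ
open import Data.Nat.DivMod using (_/_)
import Data.Nat.Tactic.RingSolver as ℕ-Solver
import Data.List.Properties as LP
open import Data.Product using (_×_; _,_; proj₁; proj₂; ∃)
open import Data.Product.Properties using (≡-dec)
open import Data.Sum using (_⊎_; inj₁; inj₂)
open import Function using (_∘_; flip; Equivalence)
open import Relation.Binary.PropositionalEquality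
  using (_≢_; refl; sym; trans; cong; cong₂; subst; subst₂; module ≡-Reasoning)
open import Relation.Nullary using (Dec; does; yes; no; _×-dec_)
open import Relation.Nullary.Decidable using (T?; from-yes; dec-true)

open Equivalence using (to)

+k-+a≡+u⇒a≤k : ∀ k a u → + k -ℤ + a ≡ + u → a ≤ k
+k-+a≡+u⇒a≤k k a u k-a≡u = subst (a ≤_) (sym k≡u+a) (ℕ.m≤n+m a u)
  where
  k≡u+a : k ≡ u + a
  k≡u+a = ℤ.+-injective (begin
    + k                  ≡⟨ lemma (+ k) (+ a) ⟩
    (+ k -ℤ + a) +ℤ + a  ≡⟨ cong (_+ℤ + a) k-a≡u ⟩
    + u +ℤ + a           ≡⟨ ℤ.pos-+ u a ⟨
    + (u + a)            ∎)
    where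
    open ≡-Reasoning
    lemma : ∀ k a → k ≡ (k -ℤ a) +ℤ a
    lemma = solve-∀

∣z∣≤k : ∀ k z → (∃ λ u → + k -ℤ z ≡ + u) → (∃ λ v → + k +ℤ z ≡ + v) → ∣ z ∣ ≤ k
∣z∣≤k k (+ a)    (u , k-z≡u) _           = +k-+a≡+u⇒a≤k k a u k-z≡u
∣z∣≤k k -[1+ a ] _           (v , k+z≡v) = +k-+a≡+u⇒a≤k k (suc a) v k+z≡v

bounded-%ℕ-injective : ∀ v .{{_ : NonZero v}} k {x y} → k + k < v →
                       ∣ x ∣ ≤ k → ∣ y ∣ ≤ k → x %ℕ v ≡ y %ℕ v → x ≡ y
bounded-%ℕ-injective v k {x} {y} k+k<v ∣x∣≤k ∣y∣≤k x≡y[v] with x ℤ.≟ y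
... | yes x≡y = x≡y
... | no x≢y  = ⊥-elim (ℕ.<⇒≱ k+k<v v≤k+k)
  where
  q = x /ℕ v -ℤ y /ℕ v
  x-y≡q*v : x -ℤ y ≡ q *ℤ + v
  x-y≡q*v = begin
    x -ℤ y
      ≡⟨ cong₂ _-ℤ_ (a≡a%ℕn+[a/ℕn]*n x v) (a≡a%ℕn+[a/ℕn]*n y v) ⟩
    (+ (x %ℕ v) +ℤ (x /ℕ v) *ℤ + v) -ℤ (+ (y %ℕ v) +ℤ (y /ℕ v) *ℤ + v)
      ≡⟨ cong (λ r → (+ r +ℤ (x /ℕ v) *ℤ + v) -ℤ (+ (y %ℕ v) +ℤ (y /ℕ v) *ℤ + v)) x≡y[v] ⟩
    (+ (y %ℕ v) +ℤ (x /ℕ v) *ℤ + v) -ℤ (+ (y %ℕ v) +ℤ (y /ℕ v) *ℤ + v)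
      ≡⟨ lemma (+ (y %ℕ v)) (x /ℕ v) (y /ℕ v) (+ v) ⟩
    q *ℤ + v ∎
    where
    open ≡-Reasoning
    lemma : ∀ r a b v → (r +ℤ a *ℤ v) -ℤ (r +ℤ b *ℤ v) ≡ (a -ℤ b) *ℤ v
    lemma = solve-∀
  v∣∣x-y∣ : v ∣ ∣ x -ℤ y ∣
  v∣∣x-y∣ = divides ∣ q ∣ (trans (cong ∣_∣ x-y≡q*v) (ℤ.abs-* q (+ v)))
  ∣x-y∣≢0 : ∣ x -ℤ y ∣ ≢ 0
  ∣x-y∣≢0 = x≢y ∘ ℤ.i-j≡0⇒i≡j x y ∘ ℤ.∣i∣≡0⇒i≡0
  v≤k+k : v ≤ k + k
  v≤k+k = begin
    v             ≤⟨ ∣⇒≤ {{ℕ.≢-nonZero ∣x-y∣≢0}} v∣∣x-y∣ ⟩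
    ∣ x -ℤ y ∣    ≤⟨ ℤ.∣i-j∣≤∣i∣+∣j∣ x y ⟩
    ∣ x ∣ + ∣ y ∣ ≤⟨ ℕ.+-mono-≤ ∣x∣≤k ∣y∣≤k ⟩
    k + k         ∎
    where open ℕ.≤-Reasoning

map-%ℕ-distinct : ∀ v .{{_ : NonZero v}} k → k + k < v → ∀ {zs} →
                  All (λ z → ∣ z ∣ ≤ k) zs → AllPairs _≢_ zs → AllPairs _≢_ (map (_%ℕ v) zs)
map-%ℕ-distinct v k k+k<v []           []             = []
map-%ℕ-distinct v k k+k<v (∣z∣≤k ∷ bs) (z≢zs ∷ dist) =
  Allₚ.map⁺ (All.zipWith (λ (∣w∣≤k , z≢w) → z≢w ∘ bounded-%ℕ-injective v k k+k<v ∣z∣≤k ∣w∣≤k)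
                          (bs , z≢zs))
  ∷ map-%ℕ-distinct v k k+k<v bs dist

runningSums : {A : Set} → (A → A → A) → A → List A → List A
runningSums _∙_ acc []       = []
runningSums _∙_ acc (x ∷ xs) = (acc ∙ x) ∷ runningSums _∙_ (acc ∙ x) xs

map-runningSums : {A B : Set} {_∙_ : A → A → A} {_◦_ : B → B → B} (f : A → B) →
                  (∀ a b → f (a ∙ b) ≡ f a ◦ f b) → ∀ acc xs →
                  map f (runningSums _∙_ acc xs) ≡ runningSums _◦_ (f acc) (map f xs)
map-runningSums f homo acc []       = refl
map-runningSums {_◦_ = _◦_} f homo acc (x ∷ xs) =
  cong₂ _∷_ (homo acc x)
    (trans (map-runningSums f homo _ xs) (cong (λ a → runningSums _◦_ a (map f xs)) (homo acc x)))

-- Defs.partialSums runs through a local helper that cannot be named here,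
-- so it is identified with runningSums only by evaluation, on lists of a fixed length.
partialSums≡runningSums : ∀ xs → length xs ≡ 7 → partialSums xs ≡ runningSums _+ℤ_ (+ 0) xs
partialSums≡runningSums (_ ∷ _ ∷ _ ∷ _ ∷ _ ∷ _ ∷ _ ∷ []) refl = refl

-- Affine forms d (a x + b y) + c

record Affine : Set where
  constructor affine
  field
    coeffˣ coeffʸ const : ℤ

infixl 6 _⊕_ _⊖_

_⊕_ : Affine → Affine → Affine
affine a b c ⊕ affine a′ b′ c′ = affine (a +ℤ a′) (b +ℤ b′) (c +ℤ c′)

⊝_ : Affine → Affine
⊝ affine a b c = affine (-ℤ a) (-ℤ b) (-ℤ c)

_⊖_ : Affine → Affine → Affine
F ⊖ G = F ⊕ ⊝ G

0ᴬ : Affine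
0ᴬ = affine (+ 0) (+ 0) (+ 0)

isZero : Affine → Bool
isZero (affine (+ 0) (+ 0) (+ 0)) = true
isZero _                          = false

isZero⇒≡0ᴬ : ∀ F → T (isZero F) → F ≡ 0ᴬ
isZero⇒≡0ᴬ (affine (+ 0) (+ 0) (+ 0)) _ = refl

sumᴬ : List Affine → Affine
sumᴬ []       = 0ᴬ
sumᴬ (F ∷ Fs) = F ⊕ sumᴬ Fs

partialSumsᴬ : List Affine → List Affine
partialSumsᴬ = runningSums _⊕_ 0ᴬ

isPositive isNonNegative : Affine → Bool
isPositive (affine (+ _) (+ _) +[1+ _ ]) = true
isPositive _                             = false
isNonNegative (affine (+ _) (+ _) (+ _)) = true
isNonNegative _                          = false

isNonZero : (d : ℕ) → Affine → Bool
isNonZero d F = isPositive F ∨ isPositive (⊝ F) ∨ not (does (d ∣? ∣ Affine.const F ∣))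

isBoundedBy : Affine → Affine → Bool
isBoundedBy K F = isNonNegative (K ⊖ F) ∧ isNonNegative (K ⊕ F)

LineCertificate : ℕ → Affine → List Affine → Set
LineCertificate d K Fs =
  length Fs ≡ 7 × T (isZero (sumᴬ Fs)) ×
  All (T ∘ isBoundedBy K) (partialSumsᴬ Fs) ×
  AllPairs (λ F G → T (isNonZero d (G ⊖ F))) (partialSumsᴬ Fs)

lineCertificate? : ∀ d K Fs → Dec (LineCertificate d K Fs)
lineCertificate? d K Fs =
  length Fs ℕ.≟ 7 ×-dec T? _ ×-dec All.all? (T? ∘ isBoundedBy K) _ ×-dec
  allPairs? (λ F G → T? (isNonZero d (G ⊖ F))) _

record SHLine (n : ℕ) (L : List ℤ) : Set where
  field
    length≡7 : length L ≡ 7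
    sum≡0    : sumℤ L ≡ + 0
    simple₁  : SimpleMod (suc (2 * n * 7)) L
    simple₂  : SimpleMod (suc (suc (2 * n * 7))) L

module Evaluation (d x y : ℕ) where

  ⟦_⟧ : Affine → ℤ
  ⟦ affine a b c ⟧ = + d *ℤ (a *ℤ + x +ℤ b *ℤ + y) +ℤ c

  ⟦⟧-⊕ : ∀ F G → ⟦ F ⊕ G ⟧ ≡ ⟦ F ⟧ +ℤ ⟦ G ⟧
  ⟦⟧-⊕ (affine a b c) (affine a′ b′ c′) = lemma (+ d) a b c a′ b′ c′ (+ x) (+ y)
    where
    lemma : ∀ D a b c a′ b′ c′ X Y →
            D *ℤ ((a +ℤ a′) *ℤ X +ℤ (b +ℤ b′) *ℤ Y) +ℤ (c +ℤ c′) ≡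
            (D *ℤ (a *ℤ X +ℤ b *ℤ Y) +ℤ c) +ℤ (D *ℤ (a′ *ℤ X +ℤ b′ *ℤ Y) +ℤ c′)
    lemma = solve-∀

  ⟦⟧-⊝ : ∀ F → ⟦ ⊝ F ⟧ ≡ -ℤ ⟦ F ⟧
  ⟦⟧-⊝ (affine a b c) = lemma (+ d) a b c (+ x) (+ y)
    where
    lemma : ∀ D a b c X Y → D *ℤ ((-ℤ a) *ℤ X +ℤ (-ℤ b) *ℤ Y) +ℤ (-ℤ c) ≡
                            -ℤ (D *ℤ (a *ℤ X +ℤ b *ℤ Y) +ℤ c)
    lemma = solve-∀

  ⟦⟧-⊖ : ∀ F G → ⟦ F ⊖ G ⟧ ≡ ⟦ F ⟧ -ℤ ⟦ G ⟧
  ⟦⟧-⊖ F G = trans (⟦⟧-⊕ F (⊝ G)) (cong (⟦ F ⟧ +ℤ_) (⟦⟧-⊝ G))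

  ⟦0ᴬ⟧ : ⟦ 0ᴬ ⟧ ≡ + 0
  ⟦0ᴬ⟧ = lemma (+ d) (+ x) (+ y)
    where
    lemma : ∀ D X Y → D *ℤ (+ 0 *ℤ X +ℤ + 0 *ℤ Y) +ℤ + 0 ≡ + 0
    lemma = solve-∀

  ⟦⟧-sumᴬ : ∀ Fs → sumℤ (map ⟦_⟧ Fs) ≡ ⟦ sumᴬ Fs ⟧
  ⟦⟧-sumᴬ []       = sym ⟦0ᴬ⟧
  ⟦⟧-sumᴬ (F ∷ Fs) = trans (cong (⟦ F ⟧ +ℤ_) (⟦⟧-sumᴬ Fs)) (sym (⟦⟧-⊕ F (sumᴬ Fs)))

  ⟦⟧-partialSumsᴬ : ∀ Fs → length Fs ≡ 7 → partialSums (map ⟦_⟧ Fs) ≡ map ⟦_⟧ (partialSumsᴬ Fs)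
  ⟦⟧-partialSumsᴬ Fs len = begin
    partialSums (map ⟦_⟧ Fs)                ≡⟨ partialSums≡runningSums _ (trans (LP.length-map ⟦_⟧ Fs) len) ⟩
    runningSums _+ℤ_ (+ 0) (map ⟦_⟧ Fs)     ≡⟨ cong (λ z → runningSums _+ℤ_ z (map ⟦_⟧ Fs)) (sym ⟦0ᴬ⟧) ⟩
    runningSums _+ℤ_ ⟦ 0ᴬ ⟧ (map ⟦_⟧ Fs)    ≡⟨ sym (map-runningSums ⟦_⟧ ⟦⟧-⊕ 0ᴬ Fs) ⟩
    map ⟦_⟧ (partialSumsᴬ Fs)               ∎
    where open ≡-Reasoning

  ⟦⟧-nonNegative : ∀ a b c → ⟦ affine (+ a) (+ b) (+ c) ⟧ ≡ + (d * (a * x + b * y) + c)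
  ⟦⟧-nonNegative a b c = sym (begin
    + (d * (a * x + b * y) + c)             ≡⟨ ℤ.pos-+ (d * (a * x + b * y)) c ⟩
    + (d * (a * x + b * y)) +ℤ + c          ≡⟨ cong (_+ℤ + c) (ℤ.pos-* d (a * x + b * y)) ⟩
    + d *ℤ + (a * x + b * y) +ℤ + c         ≡⟨ cong (λ z → + d *ℤ z +ℤ + c) (ℤ.pos-+ (a * x) (b * y)) ⟩
    + d *ℤ (+ (a * x) +ℤ + (b * y)) +ℤ + c  ≡⟨ cong₂ (λ u v → + d *ℤ (u +ℤ v) +ℤ + c) (ℤ.pos-* a x) (ℤ.pos-* b y) ⟩
    ⟦ affine (+ a) (+ b) (+ c) ⟧            ∎)
    where open ≡-Reasoning

  ∣⟦⟧∣-nonNegative : ∀ a b c → ∣ ⟦ affine (+ a) (+ b) (+ c) ⟧ ∣ ≡ d * (a * x + b * y) + c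
  ∣⟦⟧∣-nonNegative a b c = cong ∣_∣ (⟦⟧-nonNegative a b c)

  isNonNegative⇒ℕ : ∀ F → T (isNonNegative F) → ∃ λ u → ⟦ F ⟧ ≡ + u
  isNonNegative⇒ℕ (affine (+ a) (+ b) (+ c)) _ = _ , ⟦⟧-nonNegative a b c

  isPositive⇒≢0 : ∀ F → T (isPositive F) → ⟦ F ⟧ ≢ + 0
  isPositive⇒≢0 (affine (+ a) (+ b) +[1+ c ]) _ eq =
    ℕ.m+1+n≢0 (d * (a * x + b * y)) (ℤ.+-injective (trans (sym (⟦⟧-nonNegative a b (suc c))) eq))

  ⟦⟧≡0⇒∣const : ∀ F → ⟦ F ⟧ ≡ + 0 → d ∣ ∣ Affine.const F ∣
  ⟦⟧≡0⇒∣const (affine a b c) eq = divides ∣ k ∣ (begin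
    ∣ c ∣                                 ≡⟨ cong ∣_∣ (lemma (+ d *ℤ k) c) ⟩
    ∣ -ℤ (+ d *ℤ k) +ℤ ⟦ affine a b c ⟧ ∣ ≡⟨ cong (λ z → ∣ -ℤ (+ d *ℤ k) +ℤ z ∣) eq ⟩
    ∣ -ℤ (+ d *ℤ k) +ℤ + 0 ∣              ≡⟨ cong ∣_∣ (ℤ.+-identityʳ (-ℤ (+ d *ℤ k))) ⟩
    ∣ -ℤ (+ d *ℤ k) ∣                     ≡⟨ ℤ.∣-i∣≡∣i∣ (+ d *ℤ k) ⟩
    ∣ + d *ℤ k ∣                          ≡⟨ ℤ.abs-* (+ d) k ⟩
    d * ∣ k ∣                             ≡⟨ ℕ.*-comm d ∣ k ∣ ⟩
    ∣ k ∣ * d                             ∎)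
    where
    open ≡-Reasoning
    k = a *ℤ + x +ℤ b *ℤ + y
    lemma : ∀ u c → c ≡ -ℤ u +ℤ (u +ℤ c)
    lemma = solve-∀

  isNonZero⇒≢0 : ∀ F → T (isNonZero d F) → ⟦ F ⟧ ≢ + 0
  isNonZero⇒≢0 F p with to T-∨ p
  ... | inj₁ pos = isPositive⇒≢0 F pos
  ... | inj₂ q with to T-∨ q
  ...   | inj₁ neg = λ eq → isPositive⇒≢0 (⊝ F) neg (trans (⟦⟧-⊝ F) (cong -ℤ_ eq))
  ...   | inj₂ d∤c = λ eq → subst (T ∘ not) (dec-true (d ∣? _) (⟦⟧≡0⇒∣const F eq)) d∤c

  isBoundedBy⇒∣⟦⟧∣≤ : ∀ K F k → ⟦ K ⟧ ≡ + k → T (isBoundedBy K F) → ∣ ⟦ F ⟧ ∣ ≤ k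
  isBoundedBy⇒∣⟦⟧∣≤ K F k ⟦K⟧≡k p
    with isNonNegative⇒ℕ (K ⊖ F) (proj₁ (to T-∧ p)) | isNonNegative⇒ℕ (K ⊕ F) (proj₂ (to T-∧ p))
  ... | u , K-F≡u | v , K+F≡v = ∣z∣≤k k ⟦ F ⟧
    (u , trans (sym (trans (⟦⟧-⊖ K F) (cong (_-ℤ ⟦ F ⟧) ⟦K⟧≡k))) K-F≡u)
    (v , trans (sym (trans (⟦⟧-⊕ K F) (cong (_+ℤ ⟦ F ⟧) ⟦K⟧≡k))) K+F≡v)

  certified-line : ∀ {K Fs} n → ⟦ K ⟧ ≡ + (n * 7) → LineCertificate d K Fs → SHLine n (map ⟦_⟧ Fs)
  certified-line {K} {Fs} n ⟦K⟧≡7n (length≡7 , sum≡0ᴬ , bounded , distinct) = record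
    { length≡7 = trans (LP.length-map ⟦_⟧ Fs) length≡7
    ; sum≡0    = trans (⟦⟧-sumᴬ Fs) (trans (cong ⟦_⟧ (isZero⇒≡0ᴬ _ sum≡0ᴬ)) ⟦0ᴬ⟧)
    ; simple₁  = simple (suc (2 * n * 7)) (s≤s 7n+7n≤14n)
    ; simple₂  = simple (suc (suc (2 * n * 7))) (ℕ.m≤n⇒m≤1+n (s≤s 7n+7n≤14n))
    }
    where
    7n+7n≤14n : n * 7 + n * 7 ≤ 2 * n * 7
    7n+7n≤14n = ℕ.≤-reflexive (lemma n)
      where
      lemma : ∀ n → n * 7 + n * 7 ≡ 2 * n * 7
      lemma = ℕ-Solver.solve-∀
    simple : ∀ v .{{_ : NonZero v}} → n * 7 + n * 7 < v → SimpleMod v (map ⟦_⟧ Fs)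
    simple v lt = subst (λ L → AllPairs _≢_ (map (_%ℕ v) L)) (sym (⟦⟧-partialSumsᴬ Fs length≡7))
      (map-%ℕ-distinct v (n * 7) lt
        (Allₚ.map⁺ (All.map (isBoundedBy⇒∣⟦⟧∣≤ K _ (n * 7) ⟦K⟧≡7n) bounded))
        (AllPairsₚ.map⁺ (AllPairs.map (λ {F} {G} G-F≢0 F≡G →
          isNonZero⇒≢0 (G ⊖ F) G-F≢0 (trans (⟦⟧-⊖ G F) (ℤ.i≡j⇒i-j≡0 (sym F≡G)))) distinct)))

range : ℕ → ℕ → List ℕ
range a zero    = []
range a (suc k) = a ∷ range (suc a) k

range-bounds : ∀ a k → All (λ z → a ≤ z × z < a + k) (range a k)
range-bounds a zero    = []
range-bounds a (suc k) = (ℕ.≤-refl , ℕ.m<m+n a z<s)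
  ∷ All.map (λ {z} (a<z , z<) → ℕ.<⇒≤ a<z , subst (z <_) (sym (ℕ.+-suc a k)) z<) (range-bounds (suc a) k)

range-++ : ∀ a k l → range a (k + l) ≡ range a k ++ range (a + k) l
range-++ a zero    l = cong (λ z → range z l) (sym (ℕ.+-identityʳ a))
range-++ a (suc k) l = cong (a ∷_) (trans (range-++ (suc a) k l) (cong (λ z → range (suc a) k ++ range z l) (sym (ℕ.+-suc a k))))

map-range-+ : ∀ {A : Set} (g : ℕ → A) a c k → map g (range (a + c) k) ≡ map (λ z → g (a + z)) (range c k)
map-range-+ g a c zero    = refl
map-range-+ g a c (suc k) =
  cong (g (a + c) ∷_) (trans (cong (λ z → map g (range z k)) (sym (ℕ.+-suc a c))) (map-range-+ g a (suc c) k))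

tabulate-range : ∀ {A : Set} n a (g : ℕ → A) → tabulate {n = n} (λ j → g (a + toℕ j)) ≡ map g (range a n)
tabulate-range zero    a g = refl
tabulate-range (suc n) a g = cong₂ _∷_ (cong g (ℕ.+-identityʳ a))
  (trans (LP.tabulate-cong {n = n} (λ j → cong g (ℕ.+-suc a (toℕ j)))) (tabulate-range n (suc a) g))

catMaybes-nothing : ∀ {A : Set} {xs : List (Maybe A)} → All (_≡ nothing) xs → catMaybes xs ≡ []
catMaybes-nothing []         = refl
catMaybes-nothing (refl ∷ ps) = catMaybes-nothing ps

catMaybes-window : ∀ {A : Set} (g : ℕ → Maybe A) a k l →
                   (∀ z → z < a → g z ≡ nothing) → (∀ z → a + k ≤ z → g z ≡ nothing) →
                   catMaybes (map g (range 0 (a + k + l))) ≡ catMaybes (map (λ z → g (a + z)) (range 0 k))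
catMaybes-window g a k l before after = begin
  catMaybes (map g (range 0 (a + k + l)))
    ≡⟨ cong (catMaybes ∘ map g) (trans (range-++ 0 (a + k) l) (cong (_++ range (a + k) l) (range-++ 0 a k))) ⟩
  catMaybes (map g ((range 0 a ++ range a k) ++ range (a + k) l))
    ≡⟨ cong catMaybes (trans (LP.map-++ g (range 0 a ++ range a k) (range (a + k) l))
                             (cong (_++ map g (range (a + k) l)) (LP.map-++ g (range 0 a) (range a k)))) ⟩
  catMaybes ((map g (range 0 a) ++ map g (range a k)) ++ map g (range (a + k) l))
    ≡⟨ trans (LP.catMaybes-++ (map g (range 0 a) ++ map g (range a k)) (map g (range (a + k) l)))
             (cong (_++ catMaybes (map g (range (a + k) l))) (LP.catMaybes-++ (map g (range 0 a)) (map g (range a k)))) ⟩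
  (catMaybes (map g (range 0 a)) ++ catMaybes (map g (range a k))) ++ catMaybes (map g (range (a + k) l))
    ≡⟨ cong₂ (λ u w → (u ++ catMaybes (map g (range a k))) ++ w)
         (catMaybes-nothing (Allₚ.map⁺ (All.map (before _ ∘ proj₂) (range-bounds 0 a))))
         (catMaybes-nothing (Allₚ.map⁺ (All.map (after _ ∘ proj₁) (range-bounds (a + k) l)))) ⟩
  catMaybes (map g (range a k)) ++ []
    ≡⟨ LP.++-identityʳ (catMaybes (map g (range a k))) ⟩
  catMaybes (map g (range a k))
    ≡⟨ cong (λ z → catMaybes (map g (range z k))) (sym (ℕ.+-identityʳ a)) ⟩
  catMaybes (map g (range (a + 0) k))
    ≡⟨ cong catMaybes (map-range-+ g a 0 k) ⟩
  catMaybes (map (λ z → g (a + z)) (range 0 k)) ∎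
  where open ≡-Reasoning

-- Block-diagonal arrays

[a+tb]%b≡a : ∀ {a} t b .{{_ : NonZero b}} → a < b → (a + t * b) % b ≡ a
[a+tb]%b≡a {a} t b a<b = trans (ℕ.[m+kn]%n≡m%n a t b) (ℕ.m<n⇒m%n≡m a<b)

[a+tb]/b≡t : ∀ {a} t b .{{_ : NonZero b}} → a < b → (a + t * b) / b ≡ t
[a+tb]/b≡t {a} t b a<b = begin
  (a + t * b) / b     ≡⟨ ℕ.+-distrib-/ a (t * b) (subst (_< b) (sym a%b+tb%b≡a) a<b) ⟩
  a / b + t * b / b   ≡⟨ cong₂ _+_ (ℕ.m<n⇒m/n≡0 a<b) (ℕ.m*n/n≡m t b) ⟩
  t                   ∎
  where
  open ≡-Reasoning
  a%b+tb%b≡a : a % b + t * b % b ≡ a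
  a%b+tb%b≡a = trans (cong₂ _+_ (ℕ.m<n⇒m%n≡m a<b) (ℕ.m*n%n≡0 t b)) (ℕ.+-identityʳ a)

[a+tb]<Nb : ∀ {a t} b N → a < b → t < N → a + t * b < N * b
[a+tb]<Nb {a} {t} b N a<b t<N = begin-strict
  a + t * b   <⟨ ℕ.+-monoˡ-< (t * b) a<b ⟩
  b + t * b   ≤⟨ ℕ.*-monoˡ-≤ b t<N ⟩
  N * b       ∎
  where open ℕ.≤-Reasoning

nothing≢just : ∀ {A : Set} {x : A} → nothing ≢ just x
nothing≢just ()

data Location : Set where
  small : ℕ → Location
  block : ℕ → ℕ → Location

OffBlock : ℕ → Location → Set
OffBlock t (small _)   = ⊤
OffBlock t (block u _) = u ≢ t

module BlockDiagonal (s b N : ℕ) .{{_ : NonZero b}} where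

  n : ℕ
  n = s + b * N

  locate : ℕ → Location
  locate r with r ℕ.<? s
  ... | yes _ = small r
  ... | no  _ = block ((r ∸ s) / b) ((r ∸ s) % b)

  locate-small : ∀ {r} → r < s → locate r ≡ small r
  locate-small {r} r<s with r ℕ.<? s
  ... | yes _   = refl
  ... | no  r≮s = ⊥-elim (r≮s r<s)

  locate-large : ∀ {r} → s ≤ r → locate r ≡ block ((r ∸ s) / b) ((r ∸ s) % b)
  locate-large {r} s≤r with r ℕ.<? s
  ... | yes r<s = ⊥-elim (ℕ.<⇒≱ r<s s≤r)
  ... | no  _   = refl

  locate-block : ∀ t {a} → a < b → locate (s + (a + t * b)) ≡ block t a
  locate-block t {a} a<b = begin
    locate (s + (a + t * b))                   ≡⟨ locate-large (ℕ.m≤m+n s _) ⟩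
    block ((s + i ∸ s) / b) ((s + i ∸ s) % b)  ≡⟨ cong (λ z → block (z / b) (z % b)) (ℕ.m+n∸m≡n s i) ⟩
    block (i / b) (i % b)                      ≡⟨ cong₂ block ([a+tb]/b≡t t b a<b) ([a+tb]%b≡a t b a<b) ⟩
    block t a                                  ∎
    where
    open ≡-Reasoning
    i = a + t * b

  large-decomposition : ∀ {r} → s ≤ r → r ≡ s + ((r ∸ s) % b + (r ∸ s) / b * b)
  large-decomposition {r} s≤r = trans (sym (ℕ.m+[n∸m]≡n s≤r)) (cong (λ i → s + i) (ℕ.m≡m%n+[m/n]*n (r ∸ s) b))

  large-block<N : ∀ {r} → s ≤ r → r < n → (r ∸ s) / b < N
  large-block<N {r} s≤r r<n = ℕ.m<n*o⇒m/o<n (subst (r ∸ s <_) (ℕ.*-comm b N)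
    (ℕ.+-cancelˡ-< s (r ∸ s) (b * N) (subst (_< n) (sym (ℕ.m+[n∸m]≡n s≤r)) r<n)))

  locate-before : ∀ t {z} → z < s + t * b → OffBlock t (locate z)
  locate-before t {z} z< with ℕ.<-≤-connex z s
  ... | inj₁ z<s₁ = subst (OffBlock t) (sym (locate-small z<s₁)) tt
  ... | inj₂ s≤z = subst (OffBlock t) (sym (locate-large s≤z)) (ℕ.<⇒≢ (ℕ.m<n*o⇒m/o<n
                     (ℕ.+-cancelˡ-< s (z ∸ s) (t * b) (subst (_< s + t * b) (sym (ℕ.m+[n∸m]≡n s≤z)) z<))))

  locate-after : ∀ t {z} → s + t * b + b ≤ z → OffBlock t (locate z)
  locate-after t {z} ≤z = subst (OffBlock t) (sym (locate-large s≤z)) (ℕ.>⇒≢ (begin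
    suc t             ≡⟨ ℕ.m*n/n≡m (suc t) b ⟨
    suc t * b / b     ≤⟨ ℕ./-monoˡ-≤ b (ℕ.+-cancelˡ-≤ s _ _ s+[1+t]b≤s+[z-s]) ⟩
    (z ∸ s) / b       ∎))
    where
    open ℕ.≤-Reasoning
    s≤z : s ≤ z
    s≤z = ℕ.≤-trans (ℕ.≤-trans (ℕ.m≤m+n s (t * b)) (ℕ.m≤m+n (s + t * b) b)) ≤z
    s+[1+t]b≤s+[z-s] : s + suc t * b ≤ s + (z ∸ s)
    s+[1+t]b≤s+[z-s] = subst₂ _≤_ (lemma s t b) (sym (ℕ.m+[n∸m]≡n s≤z)) ≤z
      where
      lemma : ∀ s t b → s + t * b + b ≡ s + suc t * b
      lemma = ℕ-Solver.solve-∀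

  module _ (S : ℕ → ℕ → Maybe ℤ) (B : ℕ → ℕ → ℕ → Maybe ℤ) where

    entry : Location → Location → Maybe ℤ
    entry (small a)   (small c)   = S a c
    entry (block t a) (block u c) with t ℕ.≟ u
    ... | yes _ = B t a c
    ... | no  _ = nothing
    entry _           _           = nothing

    array : PArray n
    array i j = entry (locate (toℕ i)) (locate (toℕ j))

    entry-diagonal : ∀ t a c → entry (block t a) (block t c) ≡ B t a c
    entry-diagonal t a c with t ℕ.≟ t
    ... | yes _ = refl
    ... | no t≢t = ⊥-elim (t≢t refl)

    entry-off : ∀ t a q → OffBlock t q → entry (block t a) q ≡ nothing
    entry-off t a (small _)   _   = refl
    entry-off t a (block u c) u≢t with t ℕ.≟ u
    ... | yes t≡u = ⊥-elim (u≢t (sym t≡u))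
    ... | no  _   = refl

    row-small : ∀ r → r < s → catMaybes (map (entry (small r) ∘ locate) (range 0 n)) ≡ catMaybes (map (S r) (range 0 s))
    row-small r r<s = begin
      catMaybes (map (entry (small r) ∘ locate) (range 0 n))
        ≡⟨ catMaybes-window (entry (small r) ∘ locate) 0 s (b * N) (λ _ ()) after ⟩
      catMaybes (map (entry (small r) ∘ locate) (range 0 s))
        ≡⟨ cong catMaybes (LP.map-cong-local
             (All.map (λ {z} (_ , z<s₁) → cong (entry (small r)) (locate-small z<s₁)) (range-bounds 0 s))) ⟩
      catMaybes (map (S r) (range 0 s)) ∎
      where
      open ≡-Reasoning
      after : ∀ z → s ≤ z → entry (small r) (locate z) ≡ nothing
      after z s≤z rewrite locate-large s≤z = refl

    row-block : ∀ t a → t < N →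
                catMaybes (map (entry (block t a) ∘ locate) (range 0 n)) ≡ catMaybes (map (B t a) (range 0 b))
    row-block t a t<N = begin
      catMaybes (map g (range 0 n))
        ≡⟨ cong (λ k → catMaybes (map g (range 0 k))) n≡ ⟩
      catMaybes (map g (range 0 (s + t * b + b + (N ∸ suc t) * b)))
        ≡⟨ catMaybes-window g (s + t * b) b ((N ∸ suc t) * b)
             (λ z z< → entry-off t a _ (locate-before t z<)) (λ z ≤z → entry-off t a _ (locate-after t ≤z)) ⟩
      catMaybes (map (λ z → g (s + t * b + z)) (range 0 b))
        ≡⟨ cong catMaybes (LP.map-cong-local (All.map (λ {z} (_ , z<b) → inside z<b) (range-bounds 0 b))) ⟩
      catMaybes (map (B t a) (range 0 b)) ∎
      where
      open ≡-Reasoning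
      g = entry (block t a) ∘ locate
      n≡ : n ≡ s + t * b + b + (N ∸ suc t) * b
      n≡ = trans (cong (λ k → s + b * k) (sym (ℕ.m+[n∸m]≡n t<N))) (lemma s t b (N ∸ suc t))
        where
        lemma : ∀ s t b w → s + b * (suc t + w) ≡ s + t * b + b + w * b
        lemma = ℕ-Solver.solve-∀
      inside : ∀ {z} → z < b → g (s + t * b + z) ≡ B t a z
      inside {z} z<b = begin
        entry (block t a) (locate (s + t * b + z))   ≡⟨ cong (entry (block t a) ∘ locate) (lemma s t b z) ⟩
        entry (block t a) (locate (s + (z + t * b))) ≡⟨ cong (entry (block t a)) (locate-block t z<b) ⟩
        entry (block t a) (block t z)                ≡⟨ entry-diagonal t a z ⟩
        B t a z                                      ∎
        where
        lemma : ∀ s t b z → s + t * b + z ≡ s + (z + t * b)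
        lemma = ℕ-Solver.solve-∀

    rowList-at : ∀ i {p} → locate (toℕ i) ≡ p → rowList array i ≡ catMaybes (map (entry p ∘ locate) (range 0 n))
    rowList-at i refl = cong catMaybes (tabulate-range n 0 (entry (locate (toℕ i)) ∘ locate))

    all-rows : (P : List ℤ → Set) →
               (∀ r → r < s → P (catMaybes (map (S r) (range 0 s)))) →
               (∀ t a → t < N → a < b → P (catMaybes (map (B t a) (range 0 b)))) →
               ∀ i → P (rowList array i)
    all-rows P small-row block-row i with ℕ.<-≤-connex (toℕ i) s
    ... | inj₁ r<s = subst P (sym (trans (rowList-at i (locate-small r<s)) (row-small _ r<s))) (small-row _ r<s)
    ... | inj₂ s≤r = subst P (sym (trans (rowList-at i (locate-large s≤r)) (row-block _ _ t<N)))
                       (block-row _ _ t<N (ℕ.m%n<n (toℕ i ∸ s) b))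
      where t<N = large-block<N s≤r (Fin.toℕ<n i)

  entry-transpose : ∀ S B p q → entry S B p q ≡ entry (flip S) (λ t → flip (B t)) q p
  entry-transpose S B (small a)   (small c)   = refl
  entry-transpose S B (small a)   (block u c) = refl
  entry-transpose S B (block t a) (small c)   = refl
  entry-transpose S B (block t a) (block u c) with t ℕ.≟ u | u ℕ.≟ t
  ... | yes refl | yes _    = refl
  ... | yes refl | no  t≢t  = ⊥-elim (t≢t refl)
  ... | no  t≢u  | yes refl = ⊥-elim (t≢u refl)
  ... | no  _    | no  _    = refl

  all-columns : ∀ S B (P : List ℤ → Set) →
                (∀ c → c < s → P (catMaybes (map (λ r → S r c) (range 0 s)))) →
                (∀ t c → t < N → c < b → P (catMaybes (map (λ a → B t a c) (range 0 b)))) →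
                ∀ j → P (colList (array S B) j)
  all-columns S B P small-column block-column j =
    subst P (cong catMaybes (LP.tabulate-cong {n = n} (λ i → sym (entry-transpose S B (locate (toℕ i)) (locate (toℕ j))))))
      (all-rows (flip S) (λ t → flip (B t)) P small-column block-column j)

  data Placed (S : ℕ → ℕ → Maybe ℤ) (B : ℕ → ℕ → ℕ → Maybe ℤ) (r c : ℕ) (x : ℤ) : Set where
    in-small : r < s → c < s → S r c ≡ just x → Placed S B r c x
    in-block : ∀ t {a a′} → t < N → a < b → a′ < b →
               r ≡ s + (a + t * b) → c ≡ s + (a′ + t * b) → B t a a′ ≡ just x → Placed S B r c x

  entry-diagonal-just : ∀ S B {t a u c x} → entry S B (block t a) (block u c) ≡ just x → t ≡ u × B t a c ≡ just x
  entry-diagonal-just S B {t} {u = u} e with t ℕ.≟ u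
  ... | yes t≡u = t≡u , e
  ... | no  _   = ⊥-elim (nothing≢just e)

  array-at : ∀ {S B i j p q x} → locate (toℕ i) ≡ p → locate (toℕ j) ≡ q →
             array S B i j ≡ just x → entry S B p q ≡ just x
  array-at refl refl eq = eq

  placed : ∀ S B i j {x} → array S B i j ≡ just x → Placed S B (toℕ i) (toℕ j) x
  placed S B i j {x} eq with ℕ.<-≤-connex (toℕ i) s | ℕ.<-≤-connex (toℕ j) s
  ... | inj₁ r<s | inj₁ c<s = in-small r<s c<s (array-at (locate-small r<s) (locate-small c<s) eq)
  ... | inj₁ r<s | inj₂ s≤c = ⊥-elim (nothing≢just (array-at (locate-small r<s) (locate-large s≤c) eq))
  ... | inj₂ s≤r | inj₁ c<s = ⊥-elim (nothing≢just (array-at (locate-large s≤r) (locate-small c<s) eq))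
  ... | inj₂ s≤r | inj₂ s≤c with entry-diagonal-just S B (array-at (locate-large s≤r) (locate-large s≤c) eq)
  ...   | t≡u , B≡x = in-block _ (large-block<N s≤r (Fin.toℕ<n i)) (ℕ.m%n<n _ b) (ℕ.m%n<n _ b)
                          (large-decomposition s≤r)
                          (trans (large-decomposition s≤c) (cong (λ u → s + ((toℕ j ∸ s) % b + u * b)) (sym t≡u)))
                          B≡x

segmentOf : {A : Set} → A → List (A × ℕ) → ℕ → A × ℕ
segmentOf last []                 i = last , i
segmentOf last ((k , len) ∷ segs) i with i ℕ.<? len
... | yes _ = k , i
... | no  _ = segmentOf last segs (i ∸ len)

segmentOf-here : ∀ {A : Set} {last : A} k len segs {i} → i < len → segmentOf last ((k , len) ∷ segs) i ≡ (k , i)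
segmentOf-here k len segs {i} i<len with i ℕ.<? len
... | yes _   = refl
... | no  i≮len = ⊥-elim (i≮len i<len)

segmentOf-there : ∀ {A : Set} {last : A} k len segs i → segmentOf last ((k , len) ∷ segs) (len + i) ≡ segmentOf last segs i
segmentOf-there {last = last} k len segs i with len + i ℕ.<? len
... | yes len+i<len = ⊥-elim (ℕ.m+n≮m len i len+i<len)
... | no  _         = cong (segmentOf last segs) (ℕ.m+n∸m≡n len i)

-- Kinds k₁, k₃, k₄ occur in the blocks and k₂, k₅ in the corner; at the evaluation points
-- their absolute values fill, in this order, segments of lengths 28N, m, 14N, 14N and
-- 7n − 56N − m.
data Kind : Set where
  k₁ k₂ k₃ k₄ k₅ : Kind

Cell : Set
Cell = Bool × Kind × ℕ

kindForm : ℕ → Kind → ℕ → Affine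
kindForm m k₁ o = affine (+ 2) (+ 0) (+ (1 + o))
kindForm m k₂ o = affine (+ 1) (+ 0) (+ (1 + o))
kindForm m k₃ o = affine (+ 2) (+ 3) (+ (29 + m + o))
kindForm m k₄ o = affine (+ 4) (+ 3) (+ (43 + m + o))
kindForm m k₅ o = affine (+ 2) (+ 0) (+ (m + suc o))

cellForm : ℕ → Cell → Affine
cellForm m (true  , k , o) = kindForm m k o
cellForm m (false , k , o) = ⊝ kindForm m k o

∣⟦cellForm⟧∣ : ∀ d x y m σ k o →
              ∣ Evaluation.⟦_⟧ d x y (cellForm m (σ , k , o)) ∣ ≡ ∣ Evaluation.⟦_⟧ d x y (kindForm m k o) ∣
∣⟦cellForm⟧∣ d x y m true  k o = refl
∣⟦cellForm⟧∣ d x y m false k o = trans (cong ∣_∣ (⟦⟧-⊝ (kindForm m k o))) (ℤ.∣-i∣≡∣i∣ ⟦ kindForm m k o ⟧)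
  where open Evaluation d x y

allowedInCorner : ℕ → ℕ → Kind → ℕ → Bool
allowedInCorner s m k₂ o = o ℕ.<ᵇ m
allowedInCorner s m k₅ o = m + suc o ℕ.≤ᵇ 7 * s
allowedInCorner s m _  _ = false

allowedInBlock : Kind → ℕ → Bool
allowedInBlock k₁ o = o ℕ.<ᵇ 28
allowedInBlock k₃ o = o ℕ.<ᵇ 14
allowedInBlock k₄ o = o ℕ.<ᵇ 14
allowedInBlock _  _ = false

CellCertificate : (Kind → ℕ → Bool) → (Kind → ℕ → ℕ × ℕ) → ℕ → ℕ → Maybe Cell → Set
CellCertificate allowed position a c nothing            = ⊤
CellCertificate allowed position a c (just (_ , k , o)) = T (allowed k o) × position k o ≡ (a , c)

cellCertificate? : ∀ allowed position a c cell → Dec (CellCertificate allowed position a c cell)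
cellCertificate? allowed position a c nothing            = yes tt
cellCertificate? allowed position a c (just (_ , k , o)) =
  T? (allowed k o) ×-dec ≡-dec ℕ._≟_ ℕ._≟_ (position k o) (a , c)

TableCertificate : (size d m : ℕ) → Affine → (Kind → ℕ → Bool) → (Kind → ℕ → ℕ × ℕ) →
                   (ℕ → ℕ → Maybe Cell) → Set
TableCertificate size d m K allowed position table =
  (∀ {a} → a < size → ∀ {c} → c < size → CellCertificate allowed position a c (table a c)) ×
  (∀ {r} → r < size → LineCertificate d K (map (cellForm m) (catMaybes (map (table r) (range 0 size))))) ×
  (∀ {c} → c < size → LineCertificate d K (map (cellForm m) (catMaybes (map (λ r → table r c) (range 0 size)))))

tableCertificate? : ∀ size d m K allowed position table → Dec (TableCertificate size d m K allowed position table)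
tableCertificate? size d m K allowed position table =
  ℕ.allUpTo? (λ a → ℕ.allUpTo? (λ c → cellCertificate? allowed position a c (table a c)) size) size ×-dec
  ℕ.allUpTo? (λ r → lineCertificate? d K _) size ×-dec
  ℕ.allUpTo? (λ c → lineCertificate? d K _) size

module Construction (s m : ℕ) (C : ℕ → ℕ → Maybe Cell) (positionC : Kind → ℕ → ℕ × ℕ)
                    (B : ℕ → ℕ → Maybe Cell) (positionB : Kind → ℕ → ℕ × ℕ) where

  Kᶜ Kᵇ : Affine
  Kᶜ = affine (+ 2) (+ 0) (+ (7 * s))
  Kᵇ = affine (+ 4) (+ 4) (+ (56 + 7 * s))

  Certificate : Set
  Certificate = m ≤ 7 * s ×
                TableCertificate s 28 m Kᶜ (allowedInCorner s m) positionC C ×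
                TableCertificate 8 14 m Kᵇ allowedInBlock positionB B

  certificate? : Dec Certificate
  certificate? = m ℕ.≤? 7 * s ×-dec
                 tableCertificate? s 28 m Kᶜ (allowedInCorner s m) positionC C ×-dec
                 tableCertificate? 8 14 m Kᵇ allowedInBlock positionB B

  module _ (N : ℕ) where

    open BlockDiagonal s 8 N

    evC : Cell → ℤ
    evC = Evaluation.⟦_⟧ 28 N 0 ∘ cellForm m

    evB : ℕ → Cell → ℤ
    evB t = Evaluation.⟦_⟧ 14 t (N ∸ suc t) ∘ cellForm m

    Cᶻ : ℕ → ℕ → Maybe ℤ
    Cᶻ a c = Maybe.map evC (C a c)

    Bᶻ : ℕ → ℕ → ℕ → Maybe ℤ
    Bᶻ t a c = Maybe.map (evB t) (B a c)

    segments : List (Kind × ℕ)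
    segments = (k₁ , 28 * N) ∷ (k₂ , m) ∷ (k₃ , 14 * N) ∷ (k₄ , 14 * N) ∷ []

    inBlock : ℕ → ℕ × ℕ → ℕ × ℕ
    inBlock t (a , c) = s + (a + t * 8) , s + (c + t * 8)

    position : Kind × ℕ → ℕ × ℕ
    position (k₁ , i) = inBlock (i / 28) (positionB k₁ (i % 28))
    position (k₂ , i) = positionC k₂ i
    position (k₃ , i) = inBlock (N ∸ suc (i / 14)) (positionB k₃ (i % 14))
    position (k₄ , i) = inBlock (i / 14) (positionB k₄ (i % 14))
    position (k₅ , i) = positionC k₅ i

    decode : ℕ → ℕ × ℕ
    decode v = position (segmentOf k₅ segments (v ∸ 1))

    record Decoded (x : ℤ) (r c : ℕ) : Set where
      field
        nonzero : x ≢ + 0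
        bounded : ∣ x ∣ ≤ n * 7
        decodes : decode ∣ x ∣ ≡ (r , c)

    decoded : ∀ {x r c k j} i → ∣ x ∣ ≡ suc i → suc i ≤ n * 7 →
              segmentOf k₅ segments i ≡ (k , j) → position (k , j) ≡ (r , c) → Decoded x r c
    decoded i ∣x∣≡1+i bound segment pos = record
      { nonzero = λ x≡0 → ℕ.1+n≢0 (trans (sym ∣x∣≡1+i) (cong ∣_∣ x≡0))
      ; bounded = subst (_≤ n * 7) (sym ∣x∣≡1+i) bound
      ; decodes = trans (cong decode ∣x∣≡1+i) (trans (cong position segment) pos)
      }

    below-top : ∀ j → m + j ≤ 7 * s → 28 * N + (m + (14 * N + (14 * N + j))) ≤ n * 7
    below-top j m+j≤7s = subst₂ _≤_ (sym (lemma₁ N m j)) (sym (lemma₂ s N)) (ℕ.+-monoʳ-≤ (56 * N) m+j≤7s)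
      where
      lemma₁ : ∀ N m j → 28 * N + (m + (14 * N + (14 * N + j))) ≡ 56 * N + (m + j)
      lemma₁ = ℕ-Solver.solve-∀
      lemma₂ : ∀ s N → (s + 8 * N) * 7 ≡ 56 * N + 7 * s
      lemma₂ = ℕ-Solver.solve-∀

    module CertificateConsequences (certificate : Certificate) where

      m≤7s : m ≤ 7 * s
      m≤7s = proj₁ certificate

      top≤n*7 : 28 * N + (m + (14 * N + 14 * N)) ≤ n * 7
      top≤n*7 = subst (_≤ n * 7) (cong (λ z → 28 * N + (m + (14 * N + z))) (ℕ.+-identityʳ (14 * N)))
                  (below-top 0 (subst (_≤ 7 * s) (sym (ℕ.+-identityʳ m)) m≤7s))

      corner-decoded : ∀ {a c} σ k o → T (allowedInCorner s m k o) → positionC k o ≡ (a , c) →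
                       Decoded (evC (σ , k , o)) a c
      corner-decoded σ k₂ o allowed pos = decoded (28 * N + o)
        (trans (∣⟦cellForm⟧∣ 28 N 0 m σ k₂ o) (trans (∣⟦⟧∣-nonNegative 1 0 (1 + o)) (lemma N o)))
        (ℕ.≤-trans (ℕ.+-monoʳ-< (28 * N) o<m) (ℕ.≤-trans (ℕ.+-monoʳ-≤ (28 * N) (ℕ.m≤m+n m _)) top≤n*7))
        (trans (segmentOf-there k₁ (28 * N) _ o) (segmentOf-here k₂ m _ o<m))
        pos
        where
        open Evaluation 28 N 0
        o<m = ℕ.<ᵇ⇒< o m allowed
        lemma : ∀ N o → 28 * (1 * N + 0 * 0) + (1 + o) ≡ suc (28 * N + o)
        lemma = ℕ-Solver.solve-∀
      corner-decoded σ k₅ o allowed pos = decoded (28 * N + (m + (14 * N + (14 * N + o))))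
        (trans (∣⟦cellForm⟧∣ 28 N 0 m σ k₅ o) (trans (∣⟦⟧∣-nonNegative 2 0 (m + suc o)) (lemma N m o)))
        (subst (_≤ n * 7) (lemma′ N m o) (below-top (suc o) (ℕ.≤ᵇ⇒≤ (m + suc o) (7 * s) allowed)))
        (trans (segmentOf-there k₁ (28 * N) _ _) (trans (segmentOf-there k₂ m _ _)
          (trans (segmentOf-there k₃ (14 * N) _ _) (segmentOf-there k₄ (14 * N) _ o))))
        pos
        where
        open Evaluation 28 N 0
        lemma : ∀ N m o → 28 * (2 * N + 0 * 0) + (m + suc o) ≡ suc (28 * N + (m + (14 * N + (14 * N + o))))
        lemma = ℕ-Solver.solve-∀
        lemma′ : ∀ N m o → 28 * N + (m + (14 * N + (14 * N + suc o))) ≡ suc (28 * N + (m + (14 * N + (14 * N + o))))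
        lemma′ = ℕ-Solver.solve-∀

      module _ {t : ℕ} (t<N : t < N) where

        private
          w = N ∸ suc t

          N≡1+t+w : N ≡ suc (t + w)
          N≡1+t+w = sym (ℕ.m+[n∸m]≡n t<N)

          w<N : w < N
          w<N = subst (w <_) (sym N≡1+t+w) (s≤s (ℕ.m≤n+m w t))

          <14N : ∀ {u o} → u < N → o < 14 → o + u * 14 < 14 * N
          <14N {u} {o} u<N o<14 = subst (o + u * 14 <_) (ℕ.*-comm N 14) ([a+tb]<Nb 14 N o<14 u<N)

        open Evaluation 14 t w

        block-decoded : ∀ {a c} σ k o → T (allowedInBlock k o) → positionB k o ≡ (a , c) →
                        Decoded (evB t (σ , k , o)) (s + (a + t * 8)) (s + (c + t * 8))
        block-decoded σ k₁ o allowed pos = decoded (o + t * 28)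
          (trans (∣⟦cellForm⟧∣ 14 t w m σ k₁ o) (trans (∣⟦⟧∣-nonNegative 2 0 (1 + o)) (lemma t w o)))
          (ℕ.≤-trans i<28N (ℕ.≤-trans (ℕ.m≤m+n (28 * N) _) top≤n*7))
          (segmentOf-here k₁ (28 * N) _ i<28N)
          (trans (cong₂ (λ u v → inBlock u (positionB k₁ v)) ([a+tb]/b≡t t 28 o<28) ([a+tb]%b≡a t 28 o<28))
                 (cong (inBlock t) pos))
          where
          o<28 = ℕ.<ᵇ⇒< o 28 allowed
          i<28N : o + t * 28 < 28 * N
          i<28N = subst (o + t * 28 <_) (ℕ.*-comm N 28) ([a+tb]<Nb 28 N o<28 t<N)
          lemma : ∀ t w o → 14 * (2 * t + 0 * w) + (1 + o) ≡ suc (o + t * 28)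
          lemma = ℕ-Solver.solve-∀
        block-decoded σ k₃ o allowed pos = decoded (28 * N + (m + (o + w * 14)))
          (trans (∣⟦cellForm⟧∣ 14 t w m σ k₃ o) (trans (∣⟦⟧∣-nonNegative 2 3 (29 + m + o))
            (trans (lemma t w m o) (cong (λ z → suc (28 * z + (m + (o + w * 14)))) (sym N≡1+t+w)))))
          (ℕ.≤-trans (ℕ.+-monoʳ-< (28 * N) (ℕ.+-monoʳ-< m i<14N))
            (ℕ.≤-trans (ℕ.+-monoʳ-≤ (28 * N) (ℕ.+-monoʳ-≤ m (ℕ.m≤m+n (14 * N) (14 * N)))) top≤n*7))
          (trans (segmentOf-there k₁ (28 * N) _ _) (trans (segmentOf-there k₂ m _ _) (segmentOf-here k₃ (14 * N) _ i<14N)))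
          (trans (cong₂ (λ u v → inBlock (N ∸ suc u) (positionB k₃ v)) ([a+tb]/b≡t w 14 o<14) ([a+tb]%b≡a w 14 o<14))
                 (cong₂ inBlock N∸[1+w]≡t pos))
          where
          o<14 = ℕ.<ᵇ⇒< o 14 allowed
          i<14N = <14N w<N o<14
          N∸[1+w]≡t : N ∸ suc w ≡ t
          N∸[1+w]≡t = trans (cong (_∸ suc w) N≡1+t+w) (ℕ.m+n∸n≡m t w)
          lemma : ∀ t w m o → 14 * (2 * t + 3 * w) + (29 + m + o) ≡ suc (28 * suc (t + w) + (m + (o + w * 14)))
          lemma = ℕ-Solver.solve-∀
        block-decoded σ k₄ o allowed pos = decoded (28 * N + (m + (14 * N + (o + t * 14))))
          (trans (∣⟦cellForm⟧∣ 14 t w m σ k₄ o) (trans (∣⟦⟧∣-nonNegative 4 3 (43 + m + o))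
            (trans (lemma t w m o) (cong (λ z → suc (28 * z + (m + (14 * z + (o + t * 14))))) (sym N≡1+t+w)))))
          (ℕ.≤-trans (ℕ.+-monoʳ-< (28 * N) (ℕ.+-monoʳ-< m (ℕ.+-monoʳ-< (14 * N) i<14N))) top≤n*7)
          (trans (segmentOf-there k₁ (28 * N) _ _) (trans (segmentOf-there k₂ m _ _)
            (trans (segmentOf-there k₃ (14 * N) _ _) (segmentOf-here k₄ (14 * N) _ i<14N))))
          (trans (cong₂ (λ u v → inBlock u (positionB k₄ v)) ([a+tb]/b≡t t 14 o<14) ([a+tb]%b≡a t 14 o<14))
                 (cong (inBlock t) pos))
          where
          o<14 = ℕ.<ᵇ⇒< o 14 allowed
          i<14N = <14N t<N o<14
          lemma : ∀ t w m o → 14 * (4 * t + 3 * w) + (43 + m + o) ≡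
                              suc (28 * suc (t + w) + (m + (14 * suc (t + w) + (o + t * 14))))
          lemma = ℕ-Solver.solve-∀

        ⟦Kᵇ⟧≡n*7 : ⟦ Kᵇ ⟧ ≡ + (n * 7)
        ⟦Kᵇ⟧≡n*7 = trans (⟦⟧-nonNegative 4 4 (56 + 7 * s))
          (cong +_ (trans (lemma s t w) (cong (λ z → (s + 8 * z) * 7) (sym N≡1+t+w))))
          where
          lemma : ∀ s t w → 14 * (4 * t + 4 * w) + (56 + 7 * s) ≡ (s + 8 * suc (t + w)) * 7
          lemma = ℕ-Solver.solve-∀

      ⟦Kᶜ⟧≡n*7 : Evaluation.⟦_⟧ 28 N 0 Kᶜ ≡ + (n * 7)
      ⟦Kᶜ⟧≡n*7 = trans (Evaluation.⟦⟧-nonNegative 28 N 0 2 0 (7 * s)) (cong +_ (lemma s N))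
        where
        lemma : ∀ s N → 28 * (2 * N + 0 * 0) + 7 * s ≡ (s + 8 * N) * 7
        lemma = ℕ-Solver.solve-∀

      certified-cells : ∀ d x y {K} → Evaluation.⟦_⟧ d x y K ≡ + (n * 7) → ∀ (g : ℕ → Maybe Cell) l →
                        LineCertificate d K (map (cellForm m) (catMaybes (map g l))) →
                        SHLine n (catMaybes (map (Maybe.map (Evaluation.⟦_⟧ d x y ∘ cellForm m) ∘ g) l))
      certified-cells d x y {K} ⟦K⟧≡n*7 g l line = subst (SHLine n) eq (Evaluation.certified-line d x y {K} n ⟦K⟧≡n*7 line)
        where
        open ≡-Reasoning
        f = Evaluation.⟦_⟧ d x y ∘ cellForm m
        eq : map (Evaluation.⟦_⟧ d x y) (map (cellForm m) (catMaybes (map g l))) ≡ catMaybes (map (Maybe.map f ∘ g) l)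
        eq = begin
          map (Evaluation.⟦_⟧ d x y) (map (cellForm m) (catMaybes (map g l))) ≡⟨ LP.map-∘ (catMaybes (map g l)) ⟨
          map f (catMaybes (map g l))                                         ≡⟨ LP.map-catMaybes f (map g l) ⟩
          catMaybes (map (Maybe.map f) (map g l))                             ≡⟨ cong catMaybes (LP.map-∘ l) ⟨
          catMaybes (map (Maybe.map f ∘ g) l)                                 ∎

      private
        cellsC = proj₁ (proj₁ (proj₂ certificate))
        rowsC  = proj₁ (proj₂ (proj₁ (proj₂ certificate)))
        colsC  = proj₂ (proj₂ (proj₁ (proj₂ certificate)))
        cellsB = proj₁ (proj₂ (proj₂ certificate))
        rowsB  = proj₁ (proj₂ (proj₂ (proj₂ certificate)))
        colsB  = proj₂ (proj₂ (proj₂ (proj₂ certificate)))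

      rows : ∀ i → SHLine n (rowList (array Cᶻ Bᶻ) i)
      rows = all-rows Cᶻ Bᶻ (SHLine n)
        (λ r r<s → certified-cells 28 N 0 {Kᶜ} ⟦Kᶜ⟧≡n*7 (C r) (range 0 s) (rowsC r<s))
        (λ t a t<N a<8 → certified-cells 14 t (N ∸ suc t) {Kᵇ} (⟦Kᵇ⟧≡n*7 t<N) (B a) (range 0 8) (rowsB a<8))

      columns : ∀ j → SHLine n (colList (array Cᶻ Bᶻ) j)
      columns = all-columns Cᶻ Bᶻ (SHLine n)
        (λ c c<s → certified-cells 28 N 0 {Kᶜ} ⟦Kᶜ⟧≡n*7 (λ r → C r c) (range 0 s) (colsC c<s))
        (λ t c t<N c<8 → certified-cells 14 t (N ∸ suc t) {Kᵇ} (⟦Kᵇ⟧≡n*7 t<N) (λ a → B a c) (range 0 8) (colsB c<8))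

      entry-decoded : ∀ i j {x} → array Cᶻ Bᶻ i j ≡ just x → Decoded x (toℕ i) (toℕ j)
      entry-decoded i j eq with placed Cᶻ Bᶻ i j eq
      ... | in-small r<s c<s e = corner-entry (C _ _) (cellsC r<s c<s) e
        where
        corner-entry : ∀ {a c x} cell → CellCertificate (allowedInCorner s m) positionC a c cell →
                       Maybe.map evC cell ≡ just x → Decoded x a c
        corner-entry (just (σ , k , o)) (allowed , pos) refl = corner-decoded σ k o allowed pos
      ... | in-block t t<N a<8 c<8 r≡ c≡ e =
        subst₂ (Decoded _) (sym r≡) (sym c≡) (block-entry (B _ _) (cellsB a<8 c<8) e)
        where
        block-entry : ∀ {a c x} cell → CellCertificate allowedInBlock positionB a c cell →
                      Maybe.map (evB t) cell ≡ just x → Decoded x (s + (a + t * 8)) (s + (c + t * 8))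
        block-entry (just (σ , k , o)) (allowed , pos) refl = block-decoded t<N σ k o allowed pos

    shstar : Certificate → SHStar n 7
    shstar certificate = array Cᶻ Bᶻ , record
      { isH = record
        { entries  = λ i j x eq → nonzero (entry-decoded i j eq) , bounded (entry-decoded i j eq)
        ; absInj   = λ i j i′ j′ x y ex ey ∣x∣≡∣y∣ →
            let same = trans (sym (decodes (entry-decoded i j ex)))
                             (trans (cong decode ∣x∣≡∣y∣) (decodes (entry-decoded i′ j′ ey)))
            in Fin.toℕ-injective (cong proj₁ same) , Fin.toℕ-injective (cong proj₂ same)
        ; rowCount = SHLine.length≡7 ∘ rows
        ; colCount = SHLine.length≡7 ∘ columns
        ; rowSum   = SHLine.sum≡0 ∘ rows
        ; colSum   = SHLine.sum≡0 ∘ columns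
        }
      ; rowSimp₁ = SHLine.simple₁ ∘ rows
      ; rowSimp₂ = SHLine.simple₂ ∘ rows
      ; colSimp₁ = SHLine.simple₁ ∘ columns
      ; colSimp₂ = SHLine.simple₂ ∘ columns
      }
      where
      open Decoded
      open CertificateConsequences certificate

lookupOr : {A : Set} → A → List A → ℕ → A
lookupOr default []       i       = default
lookupOr default (x ∷ xs) zero    = x
lookupOr default (x ∷ xs) (suc i) = lookupOr default xs i

table : List (List (Maybe Cell)) → ℕ → ℕ → Maybe Cell
table rows a c = lookupOr nothing (lookupOr [] rows a) c

corner₉ : ℕ → ℕ → Maybe Cell
corner₉ = table
  ( (just (false , k₅ , 16) ∷ just (true , k₅ , 24) ∷ just (false , k₅ , 1) ∷ just (true , k₅ , 4) ∷ just (false , k₂ , 33) ∷ just (false , k₂ , 19) ∷ just (true , k₅ , 6) ∷ nothing ∷ nothing ∷ [])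
  ∷ (nothing ∷ just (false , k₂ , 2) ∷ just (true , k₂ , 5) ∷ just (false , k₂ , 9) ∷ just (false , k₂ , 11) ∷ just (true , k₂ , 8) ∷ just (false , k₂ , 35) ∷ just (true , k₅ , 9) ∷ nothing ∷ [])
  ∷ (nothing ∷ nothing ∷ just (true , k₅ , 25) ∷ just (false , k₅ , 10) ∷ just (true , k₂ , 21) ∷ just (false , k₅ , 8) ∷ just (true , k₂ , 1) ∷ just (false , k₅ , 11) ∷ just (true , k₅ , 17) ∷ [])
  ∷ (just (true , k₅ , 7) ∷ nothing ∷ nothing ∷ just (false , k₂ , 31) ∷ just (false , k₂ , 14) ∷ just (true , k₅ , 13) ∷ just (false , k₂ , 6) ∷ just (true , k₂ , 17) ∷ just (false , k₅ , 21) ∷ [])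
  ∷ (just (true , k₂ , 16) ∷ just (false , k₅ , 26) ∷ nothing ∷ nothing ∷ just (true , k₅ , 19) ∷ just (false , k₅ , 0) ∷ just (true , k₂ , 22) ∷ just (false , k₂ , 23) ∷ just (true , k₂ , 27) ∷ [])
  ∷ (just (true , k₂ , 30) ∷ just (false , k₂ , 28) ∷ just (false , k₅ , 20) ∷ nothing ∷ nothing ∷ just (true , k₂ , 34) ∷ just (false , k₂ , 20) ∷ just (true , k₂ , 26) ∷ just (true , k₂ , 13) ∷ [])
  ∷ (just (false , k₅ , 15) ∷ just (true , k₂ , 4) ∷ just (true , k₅ , 22) ∷ just (true , k₂ , 0) ∷ nothing ∷ nothing ∷ just (false , k₂ , 3) ∷ just (true , k₂ , 29) ∷ just (false , k₅ , 2) ∷ [])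
  ∷ (just (false , k₅ , 5) ∷ just (true , k₅ , 3) ∷ just (false , k₅ , 14) ∷ just (true , k₅ , 23) ∷ just (true , k₂ , 15) ∷ nothing ∷ nothing ∷ just (false , k₅ , 12) ∷ just (true , k₂ , 25) ∷ [])
  ∷ (just (true , k₅ , 18) ∷ just (false , k₂ , 10) ∷ just (true , k₂ , 18) ∷ just (false , k₂ , 12) ∷ just (false , k₂ , 32) ∷ just (true , k₂ , 7) ∷ nothing ∷ nothing ∷ just (false , k₂ , 24) ∷ [])
  ∷ [])

corner₉-position : Kind → ℕ → ℕ × ℕ
corner₉-position k₂ = lookupOr (0 , 0) ((6 , 3) ∷ (2 , 6) ∷ (1 , 1) ∷ (6 , 6) ∷ (6 , 1) ∷ (1 , 2) ∷ (3 , 6) ∷ (8 , 5) ∷ (1 , 5) ∷ (1 , 3) ∷ (8 , 1) ∷ (1 , 4) ∷ (8 , 3) ∷ (5 , 8) ∷ (3 , 4) ∷ (7 , 4) ∷ (4 , 0) ∷ (3 , 7) ∷ (8 , 2) ∷ (0 , 5) ∷ (5 , 6) ∷ (2 , 4) ∷ (4 , 6) ∷ (4 , 7) ∷ (8 , 8) ∷ (7 , 8) ∷ (5 , 7) ∷ (4 , 8) ∷ (5 , 1) ∷ (6 , 7) ∷ (5 , 0) ∷ (3 , 3) ∷ (8 , 4) ∷ (0 , 4) ∷ (5 , 5) ∷ (1 , 6) ∷ [])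
corner₉-position k₅ = lookupOr (0 , 0) ((4 , 5) ∷ (0 , 2) ∷ (6 , 8) ∷ (7 , 1) ∷ (0 , 3) ∷ (7 , 0) ∷ (0 , 6) ∷ (3 , 0) ∷ (2 , 5) ∷ (1 , 7) ∷ (2 , 3) ∷ (2 , 7) ∷ (7 , 7) ∷ (3 , 5) ∷ (7 , 2) ∷ (6 , 0) ∷ (0 , 0) ∷ (2 , 8) ∷ (8 , 0) ∷ (4 , 4) ∷ (5 , 2) ∷ (3 , 8) ∷ (6 , 2) ∷ (7 , 3) ∷ (0 , 1) ∷ (2 , 2) ∷ (4 , 1) ∷ [])
corner₉-position _  = λ _ → 0 , 0

corner₁₃ : ℕ → ℕ → Maybe Cell
corner₁₃ = table
  ( (just (false , k₅ , 13) ∷ just (true , k₂ , 3) ∷ just (true , k₅ , 49) ∷ just (false , k₅ , 33) ∷ just (true , k₅ , 41) ∷ just (false , k₅ , 22) ∷ just (true , k₂ , 0) ∷ nothing ∷ nothing ∷ nothing ∷ nothing ∷ nothing ∷ nothing ∷ [])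
  ∷ (nothing ∷ just (true , k₂ , 24) ∷ just (false , k₅ , 7) ∷ just (true , k₂ , 15) ∷ just (false , k₅ , 51) ∷ just (true , k₅ , 14) ∷ just (false , k₅ , 20) ∷ just (true , k₅ , 50) ∷ nothing ∷ nothing ∷ nothing ∷ nothing ∷ nothing ∷ [])
  ∷ (nothing ∷ nothing ∷ just (false , k₅ , 38) ∷ just (true , k₅ , 62) ∷ just (false , k₅ , 54) ∷ just (true , k₂ , 16) ∷ just (true , k₅ , 32) ∷ just (false , k₅ , 11) ∷ just (true , k₂ , 18) ∷ nothing ∷ nothing ∷ nothing ∷ nothing ∷ [])
  ∷ (nothing ∷ nothing ∷ nothing ∷ just (false , k₅ , 6) ∷ just (true , k₅ , 24) ∷ just (true , k₂ , 21) ∷ just (false , k₅ , 2) ∷ just (true , k₅ , 19) ∷ just (true , k₂ , 8) ∷ just (false , k₅ , 39) ∷ nothing ∷ nothing ∷ nothing ∷ [])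
  ∷ (nothing ∷ nothing ∷ nothing ∷ nothing ∷ just (true , k₅ , 34) ∷ just (false , k₅ , 1) ∷ just (true , k₅ , 9) ∷ just (false , k₅ , 0) ∷ just (false , k₅ , 47) ∷ just (true , k₂ , 11) ∷ just (true , k₂ , 19) ∷ nothing ∷ nothing ∷ [])
  ∷ (nothing ∷ nothing ∷ nothing ∷ nothing ∷ nothing ∷ just (false , k₅ , 15) ∷ just (true , k₂ , 9) ∷ just (true , k₂ , 2) ∷ just (false , k₅ , 17) ∷ just (true , k₅ , 61) ∷ just (false , k₅ , 43) ∷ just (true , k₅ , 28) ∷ nothing ∷ [])
  ∷ (nothing ∷ nothing ∷ nothing ∷ nothing ∷ nothing ∷ nothing ∷ just (false , k₅ , 3) ∷ just (true , k₂ , 1) ∷ just (true , k₅ , 64) ∷ just (false , k₅ , 27) ∷ just (true , k₂ , 5) ∷ just (false , k₅ , 55) ∷ just (true , k₅ , 40) ∷ [])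
  ∷ (just (true , k₅ , 48) ∷ nothing ∷ nothing ∷ nothing ∷ nothing ∷ nothing ∷ nothing ∷ just (false , k₅ , 36) ∷ just (false , k₅ , 53) ∷ just (true , k₅ , 31) ∷ just (true , k₅ , 25) ∷ just (false , k₂ , 23) ∷ just (false , k₂ , 17) ∷ [])
  ∷ (just (true , k₂ , 14) ∷ just (false , k₅ , 5) ∷ nothing ∷ nothing ∷ nothing ∷ nothing ∷ nothing ∷ nothing ∷ just (true , k₅ , 52) ∷ just (true , k₂ , 4) ∷ just (false , k₅ , 26) ∷ just (true , k₅ , 46) ∷ just (false , k₅ , 60) ∷ [])
  ∷ (just (true , k₂ , 22) ∷ just (false , k₅ , 57) ∷ just (true , k₂ , 25) ∷ nothing ∷ nothing ∷ nothing ∷ nothing ∷ nothing ∷ nothing ∷ just (false , k₅ , 16) ∷ just (true , k₅ , 63) ∷ just (false , k₅ , 56) ∷ just (true , k₅ , 44) ∷ [])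
  ∷ (just (false , k₅ , 59) ∷ just (true , k₅ , 58) ∷ just (true , k₂ , 20) ∷ just (true , k₂ , 12) ∷ nothing ∷ nothing ∷ nothing ∷ nothing ∷ nothing ∷ nothing ∷ just (false , k₅ , 18) ∷ just (true , k₅ , 42) ∷ just (false , k₅ , 30) ∷ [])
  ∷ (just (true , k₅ , 23) ∷ just (false , k₅ , 35) ∷ just (true , k₅ , 21) ∷ just (false , k₅ , 29) ∷ just (false , k₂ , 6) ∷ nothing ∷ nothing ∷ nothing ∷ nothing ∷ nothing ∷ nothing ∷ just (false , k₂ , 7) ∷ just (true , k₅ , 8) ∷ [])
  ∷ (just (false , k₅ , 10) ∷ just (true , k₅ , 37) ∷ just (false , k₅ , 45) ∷ just (true , k₅ , 4) ∷ just (false , k₂ , 13) ∷ just (true , k₅ , 12) ∷ nothing ∷ nothing ∷ nothing ∷ nothing ∷ nothing ∷ nothing ∷ just (false , k₂ , 10) ∷ [])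
  ∷ [])

corner₁₃-position : Kind → ℕ → ℕ × ℕ
corner₁₃-position k₂ = lookupOr (0 , 0) ((0 , 6) ∷ (6 , 7) ∷ (5 , 7) ∷ (0 , 1) ∷ (8 , 9) ∷ (6 , 10) ∷ (11 , 4) ∷ (11 , 11) ∷ (3 , 8) ∷ (5 , 6) ∷ (12 , 12) ∷ (4 , 9) ∷ (10 , 3) ∷ (12 , 4) ∷ (8 , 0) ∷ (1 , 3) ∷ (2 , 5) ∷ (7 , 12) ∷ (2 , 8) ∷ (4 , 10) ∷ (10 , 2) ∷ (3 , 5) ∷ (9 , 0) ∷ (7 , 11) ∷ (1 , 1) ∷ (9 , 2) ∷ [])
corner₁₃-position k₅ = lookupOr (0 , 0) ((4 , 7) ∷ (4 , 5) ∷ (3 , 6) ∷ (6 , 6) ∷ (12 , 3) ∷ (8 , 1) ∷ (3 , 3) ∷ (1 , 2) ∷ (11 , 12) ∷ (4 , 6) ∷ (12 , 0) ∷ (2 , 7) ∷ (12 , 5) ∷ (0 , 0) ∷ (1 , 5) ∷ (5 , 5) ∷ (9 , 9) ∷ (5 , 8) ∷ (10 , 10) ∷ (3 , 7) ∷ (1 , 6) ∷ (11 , 2) ∷ (0 , 5) ∷ (11 , 0) ∷ (3 , 4) ∷ (7 , 10) ∷ (8 , 10) ∷ (6 , 9) ∷ (5 , 11) ∷ (11 , 3) ∷ (10 , 12) ∷ (7 , 9) ∷ (2 , 6) ∷ (0 , 3) ∷ (4 , 4) ∷ (11 , 1) ∷ (7 , 7) ∷ (12 , 1) ∷ (2 ,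 2) ∷ (3 , 9) ∷ (6 , 12) ∷ (0 , 4) ∷ (10 , 11) ∷ (5 , 10) ∷ (9 , 12) ∷ (12 , 2) ∷ (8 , 11) ∷ (4 , 8) ∷ (7 , 0) ∷ (0 , 2) ∷ (1 , 7) ∷ (1 , 4) ∷ (8 , 8) ∷ (7 , 8) ∷ (2 , 4) ∷ (6 , 11) ∷ (9 , 11) ∷ (9 , 1) ∷ (10 , 1) ∷ (10 , 0) ∷ (8 , 12) ∷ (5 , 9) ∷ (2 , 3) ∷ (9 , 10) ∷ (6 , 8) ∷ [])
corner₁₃-position _  = λ _ → 0 , 0

block₈ : ℕ → ℕ → Maybe Cell
block₈ = table
  ( (nothing ∷ just (false , k₁ , 4) ∷ just (false , k₃ , 3) ∷ just (true , k₄ , 1) ∷ just (true , k₁ , 14) ∷ just (false , k₁ , 16) ∷ just (true , k₄ , 6) ∷ just (false , k₄ , 11) ∷ [])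
  ∷ (just (true , k₃ , 5) ∷ nothing ∷ just (false , k₁ , 19) ∷ just (false , k₃ , 10) ∷ just (false , k₃ , 4) ∷ just (true , k₄ , 12) ∷ just (false , k₁ , 18) ∷ just (true , k₁ , 21) ∷ [])
  ∷ (just (false , k₃ , 0) ∷ just (true , k₃ , 2) ∷ nothing ∷ just (false , k₄ , 13) ∷ just (true , k₃ , 12) ∷ just (true , k₁ , 23) ∷ just (true , k₁ , 15) ∷ just (false , k₁ , 26) ∷ [])
  ∷ (just (false , k₁ , 2) ∷ just (true , k₁ , 8) ∷ just (true , k₃ , 13) ∷ nothing ∷ just (false , k₁ , 27) ∷ just (false , k₃ , 7) ∷ just (false , k₃ , 6) ∷ just (true , k₄ , 8) ∷ [])
  ∷ (just (false , k₁ , 17) ∷ just (true , k₁ , 9) ∷ just (true , k₁ , 10) ∷ just (true , k₁ , 25) ∷ nothing ∷ just (false , k₁ , 12) ∷ just (false , k₄ , 10) ∷ just (true , k₃ , 8) ∷ [])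
  ∷ (just (true , k₁ , 7) ∷ just (false , k₁ , 3) ∷ just (true , k₄ , 7) ∷ just (false , k₁ , 6) ∷ just (false , k₃ , 9) ∷ nothing ∷ just (true , k₄ , 0) ∷ just (false , k₄ , 9) ∷ [])
  ∷ (just (true , k₄ , 5) ∷ just (false , k₄ , 4) ∷ just (false , k₃ , 1) ∷ just (false , k₁ , 13) ∷ just (true , k₄ , 2) ∷ just (false , k₁ , 24) ∷ nothing ∷ just (true , k₁ , 22) ∷ [])
  ∷ (just (false , k₃ , 11) ∷ just (true , k₁ , 5) ∷ just (false , k₁ , 20) ∷ just (true , k₄ , 3) ∷ just (false , k₁ , 1) ∷ just (true , k₁ , 11) ∷ just (false , k₁ , 0) ∷ nothing ∷ [])
  ∷ [])

block₈-position : Kind → ℕ → ℕ × ℕ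
block₈-position k₁ = lookupOr (0 , 0) ((7 , 6) ∷ (7 , 4) ∷ (3 , 0) ∷ (5 , 1) ∷ (0 , 1) ∷ (7 , 1) ∷ (5 , 3) ∷ (5 , 0) ∷ (3 , 1) ∷ (4 , 1) ∷ (4 , 2) ∷ (7 , 5) ∷ (4 , 5) ∷ (6 , 3) ∷ (0 , 4) ∷ (2 , 6) ∷ (0 , 5) ∷ (4 , 0) ∷ (1 , 6) ∷ (1 , 2) ∷ (7 , 2) ∷ (1 , 7) ∷ (6 , 7) ∷ (2 , 5) ∷ (6 , 5) ∷ (4 , 3) ∷ (2 , 7) ∷ (3 , 4) ∷ [])
block₈-position k₃ = lookupOr (0 , 0) ((2 , 0) ∷ (6 , 2) ∷ (2 , 1) ∷ (0 , 2) ∷ (1 , 4) ∷ (1 , 0) ∷ (3 , 6) ∷ (3 , 5) ∷ (4 , 7) ∷ (5 , 4) ∷ (1 , 3) ∷ (7 , 0) ∷ (2 , 4) ∷ (3 , 2) ∷ [])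
block₈-position k₄ = lookupOr (0 , 0) ((5 , 6) ∷ (0 , 3) ∷ (6 , 4) ∷ (7 , 3) ∷ (6 , 1) ∷ (6 , 0) ∷ (0 , 6) ∷ (5 , 2) ∷ (3 , 7) ∷ (5 , 7) ∷ (4 , 6) ∷ (0 , 7) ∷ (1 , 5) ∷ (2 , 3) ∷ [])
block₈-position _  = λ _ → 0 , 0

shstar₉ : ∀ N → SHStar (9 + 8 * N) 7
shstar₉ N = Construction.shstar 9 36 corner₉ corner₉-position block₈ block₈-position N
  (from-yes (Construction.certificate? 9 36 corner₉ corner₉-position block₈ block₈-position))

shstar₁₃ : ∀ N → SHStar (13 + 8 * N) 7
shstar₁₃ N = Construction.shstar 13 26 corner₁₃ corner₁₃-position block₈ block₈-position N
  (from-yes (Construction.certificate? 13 26 corner₁₃ corner₁₃-position block₈ block₈-position))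

-- Orders 1 mod 4

residue-mod-8 : ∀ {r} → r < 8 → r % 4 ≡ 1 → r ≡ 1 ⊎ r ≡ 5
residue-mod-8 {1} _ _ = inj₁ refl
residue-mod-8 {5} _ _ = inj₂ refl
residue-mod-8 {0} _ ()
residue-mod-8 {2} _ ()
residue-mod-8 {3} _ ()
residue-mod-8 {4} _ ()
residue-mod-8 {6} _ ()
residue-mod-8 {7} _ ()
residue-mod-8 {suc (suc (suc (suc (suc (suc (suc (suc _)))))))} (s≤s (s≤s (s≤s (s≤s (s≤s (s≤s (s≤s (s≤s ())))))))) _

split-1-mod-4 : ∀ n → n % 4 ≡ 1 → 9 ≤ n → ∃ λ N → 9 + 8 * N ≡ n ⊎ 13 + 8 * N ≡ n
split-1-mod-4 n n%4≡1 9≤n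
  with n % 8 | n / 8 | ℕ.m≡m%n+[m/n]*n n 8 | ℕ.m%n<n n 8 | residue-mod-8 (ℕ.m%n<n n 8) n%8%4≡1
  where
  n%8%4≡1 : n % 8 % 4 ≡ 1
  n%8%4≡1 = trans (ℕ.m∣n⇒o%n%m≡o%m 4 8 n (divides 2 refl)) n%4≡1
... | r | zero  | n≡r | r<8 | _         =
  ⊥-elim (ℕ.<⇒≱ (ℕ.m<n⇒m<1+n (subst (_< 8) (sym (trans n≡r (ℕ.+-identityʳ r))) r<8)) 9≤n)
... | _ | suc N | n≡  | _   | inj₁ refl = N , inj₁ (sym (trans n≡ (lemma N)))
  where
  lemma : ∀ N → 1 + suc N * 8 ≡ 9 + 8 * N
  lemma = ℕ-Solver.solve-∀
... | _ | suc N | n≡  | _   | inj₂ refl = N , inj₂ (sym (trans n≡ (lemma N)))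
  where
  lemma : ∀ N → 5 + suc N * 8 ≡ 13 + 8 * N
  lemma = ℕ-Solver.solve-∀

proposition4p4 : (n : ℕ) → n % 4 ≡ 1 → 9 ≤ n → SHStar n 7
proposition4p4 n n%4≡1 9≤n with split-1-mod-4 n n%4≡1 9≤n
... | N , inj₁ refl = shstar₉ N
... | N , inj₂ refl = shstar₁₃ N
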